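{- Let $G$ be a proper interval graph with vertices $1,\dots,n$ in canonical ordering, let $C\ge 1$ and $k=\lfloor(\omega(G)-1)/C\rfloor$. If vertex $i$ is secondarily forbidden, then in no $[k+1,C]$-block partition of $G$ is there a part whose rightmost vertex (in canonical ordering) is $i$.
   Context: A proper interval graph has an interval representation (intervals on the real line, none properly containing another, distinct vertices adjacent iff intervals intersect). The canonical ordering orders vertices by left endpoint, ties broken by right endpoint; vertices are identified with positions $1,\dots,n$. The block $[a,b]$ is $\{a,\dots,b\}$. $\omega(G)$ is the maximum clique size. A vertex $i$ is primarily forbidden if the block $[i-kC,i+1]$ (with $1\le i-kC$, $i+1\le n$) is a clique. The forbidden vertices form the smallest set containing all primarily forbidden vertices and closed under the following rule: if for some vertex $v$ and some $1\le s\le C-1$ every vertex of the block $[v-s+1,v]$ is forbidden and the block $[v-kC,v-s+1]$ is a clique, then every vertex $v-qC$ with $1\le q\le k$ is forbidden; vertices of the form $v-qC$ obtained through this rule are called secondarily forbidden. A $[\lambda,C]$-block partition of $G$ is a partition of the vertex set into blocks, each inducing a connected subgraph and of size at most $C$, such that every clique of $G$ intersects at most $\lambda$ parts. -}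

module Defs where

open import Data.Nat using (ℕ; zero; suc; _+_; _*_; _∸_; _≤_; _<_)
open import Data.Product using (Σ; ∃; _×_; _,_)
open import Data.Sum using (_⊎_)
open import Data.List using (List; length)
open import Data.List.Relation.Unary.All using (All)
open import Data.List.Relation.Unary.Unique.Propositional using (Unique)
open import Data.List.Membership.Propositional using (_∈_)
open import Relation.Binary.PropositionalEquality using (_≡_; _≢_)
open import Relation.Nullary using (¬_)

InV : ℕ → ℕ → Set
InV n x = 1 ≤ x × x ≤ n

ProperlyContains : (ℕ → ℕ) → (ℕ → ℕ) → ℕ → ℕ → Set
ProperlyContains l r j i = l j ≤ l i × r i ≤ r j × (l i ≢ l j ⊎ r i ≢ r j)

-- A proper interval graph on vertices 1 … n, given together with an interval
-- representation (closed intervals [l x , r x]) whose canonical ordering is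
-- the ordering 1 … n.  Endpoints are natural numbers (WLOG for finitely many
-- intervals).
record PIG (n : ℕ) : Set where
  field
    l r       : ℕ → ℕ
    nonempty  : ∀ x → InV n x → l x ≤ r x
    proper    : ∀ x y → InV n x → InV n y → ¬ ProperlyContains l r x y
    canonical : ∀ x y → InV n x → InV n y → x < y →
                l x < l y ⊎ (l x ≡ l y × r x ≤ r y)

module _ {n : ℕ} (G : PIG n) where
  open PIG G

  Adj : ℕ → ℕ → Set
  Adj x y = InV n x × InV n y × x ≢ y × l x ≤ r y × l y ≤ r x

  IsClique : List ℕ → Set
  IsClique K = Unique K × All (InV n) K ×
               (∀ x y → x ∈ K → y ∈ K → x ≢ y → Adj x y)

  IsOmega : ℕ → Set
  IsOmega w = (Σ (List ℕ) λ K → IsClique K × length K ≡ w) ×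
              (∀ K → IsClique K → length K ≤ w)

  InBlock : ℕ → ℕ → ℕ → Set
  InBlock a b x = a ≤ x × x ≤ b

  BlockClique : ℕ → ℕ → Set
  BlockClique a b = 1 ≤ a × b ≤ n ×
                    (∀ x y → InBlock a b x → InBlock a b y → x ≢ y → Adj x y)

  data Reach (a b : ℕ) : ℕ → ℕ → Set where
    here : ∀ {x} → Reach a b x x
    step : ∀ {x y z} → Adj x y → InBlock a b y → Reach a b y z → Reach a b x z

  BlockConnected : ℕ → ℕ → Set
  BlockConnected a b = ∀ x y → InBlock a b x → InBlock a b y → Reach a b x y

  Meets : List ℕ → ℕ × ℕ → Set
  Meets K (a , b) = ∃ λ x → x ∈ K × InBlock a b x

  GoodPart : ℕ → ℕ × ℕ → Set
  GoodPart C (a , b) = 1 ≤ a × a ≤ b × b ≤ n × suc b ≤ a + C × BlockConnected a b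

  -- a [λ,C]-block partition; parts are blocks [a,b] represented as pairs (a , b)
  record BlockPartition (lam C : ℕ) : Set where
    field
      parts   : List (ℕ × ℕ)
      good    : All (GoodPart C) parts
      cover   : ∀ x → InV n x → ∃ λ p → p ∈ parts × InBlock (Data.Product.proj₁ p) (Data.Product.proj₂ p) x
      disjoint : ∀ a b a' b' x → (a , b) ∈ parts → (a' , b') ∈ parts →
                 InBlock a b x → InBlock a' b' x → (a , b) ≡ (a' , b')
      cliques : ∀ K → IsClique K → (Ps : List (ℕ × ℕ)) → Unique Ps →
                All (_∈ parts) Ps → All (Meets K) Ps → length Ps ≤ lam

  module _ (C k : ℕ) where
    PrimForbidden : ℕ → Set
    PrimForbidden i = ∃ λ a → a + k * C ≡ i × BlockClique a (suc i)

    RulePremise : (ℕ → Set) → ℕ → ℕ → Set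
    RulePremise F v s = 1 ≤ s × s ≤ C ∸ 1 ×
      (∃ λ u → u + s ≡ suc v × (∀ x → InBlock u v x → F x) ×
        (∃ λ a → a + k * C ≡ v × BlockClique a u))

    data Forbidden : ℕ → Set where
      prim : ∀ {i} → PrimForbidden i → Forbidden i
      rule : ∀ {v s q i} → RulePremise Forbidden v s → 1 ≤ q → q ≤ k →
             i + q * C ≡ v → Forbidden i

    SecForbidden : ℕ → Set
    SecForbidden i = ∃ λ v → ∃ λ s → ∃ λ q →
      RulePremise Forbidden v s × 1 ≤ q × q ≤ k × i + q * C ≡ v

-- Fix a [λ,C]-block partition P.  Call c a *boundary* of P if no part
-- contains both c ∸ 1 and c; the successor of a right end and every left end
-- are boundaries.  Below a boundary y, the part containing y ∸ 1 ends at
-- y ∸ 1 and has length at most C, so its left end is again a boundary at most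
-- C steps further left.  Iterating ("chain"), a window [x , y) ending at a
-- boundary holds m distinct parts with right ends in the window as soon as
-- x + (m ∸ 1)·C < y.  Windows on either side of a boundary combine, since
-- their parts are told apart by their right ends.
--
-- The counting lemma "crowded" applies this around a right end i: a clique
-- block [x₀ , t] with x₀ + rC ≤ i, whose last vertex t lies in a part that
-- extends beyond i + qC, meets (r + 1) + (q + 1) parts.  With λ = k + 1 this is
-- too many both for primarily forbidden vertices (r = k, q = 0) and for
-- vertices v − qC produced by the closure rule (r = k − q), so by induction on
-- the closure no forbidden vertex is a right end.
module Submission where

open import Defs
open import Data.Nat using (ℕ; zero; suc; _+_; _*_; _∸_; _≤_; _<_; _≤?_; z≤n; s≤s; NonZero)
open import Data.Nat.Properties
open import Data.Nat.DivMod using (_/_)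
open import Data.Product using (Σ; ∃; _×_; _,_; proj₁; proj₂)
open import Data.Sum using (_⊎_; inj₁; inj₂)
open import Data.List using (List; []; _∷_; length; _++_; applyUpTo)
open import Data.List.Properties using (length-++)
open import Data.List.Relation.Unary.All as All using (All; []; _∷_)
import Data.List.Relation.Unary.All.Properties as AllP
open import Data.List.Relation.Unary.AllPairs using ([]; _∷_)
open import Data.List.Relation.Unary.Unique.Propositional using (Unique)
open import Data.List.Relation.Unary.Unique.Propositional.Properties using (++⁺; applyUpTo⁺₁)
open import Data.List.Membership.Propositional using (_∈_)
open import Data.List.Membership.Propositional.Properties using (∈-applyUpTo⁺; ∈-applyUpTo⁻)
open import Relation.Binary.PropositionalEquality
open import Relation.Nullary using (¬_; yes; no)
open import Data.Empty using (⊥; ⊥-elim)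

x+[1+m]c≡x+mc+c : ∀ x m c → x + suc m * c ≡ x + m * c + c
x+[1+m]c≡x+mc+c x m c = begin
  x + (c + m * c)  ≡⟨ cong (x +_) (+-comm c (m * c)) ⟩
  x + (m * c + c)  ≡⟨ +-assoc x (m * c) c ⟨
  x + m * c + c    ∎
  where open ≡-Reasoning

room-shrinks : ∀ x m c y → suc (x + suc m * c) ≤ y + c → suc (x + m * c) ≤ y
room-shrinks x m c y room =
  +-cancelʳ-≤ c (suc (x + m * c)) y
    (subst (λ e → suc e ≤ y + c) (x+[1+m]c≡x+mc+c x m c) room)

drop-multiples : ∀ {x i k q} c → x + k * c ≡ i + q * c → q ≤ k → x + (k ∸ q) * c ≡ i
drop-multiples {x} {i} {k} {q} c eq q≤k = +-cancelʳ-≡ (q * c) (x + (k ∸ q) * c) i (begin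
  x + (k ∸ q) * c + q * c    ≡⟨ +-assoc x ((k ∸ q) * c) (q * c) ⟩
  x + ((k ∸ q) * c + q * c)  ≡⟨ cong (x +_) (*-distribʳ-+ c (k ∸ q) q) ⟨
  x + ((k ∸ q) + q) * c      ≡⟨ cong (λ m → x + m * c) (m∸n+n≡m q≤k) ⟩
  x + k * c                  ≡⟨ eq ⟩
  i + q * c                  ∎)
  where open ≡-Reasoning

below-gap : ∀ {u s i q} c → u + s ≡ suc (i + q * c) → s ≤ c → 1 ≤ q → i < u
below-gap {u} {s} {i} {suc q} c eq s≤c _ =
  +-cancelʳ-< (suc q * c) i u (begin
    suc (i + suc q * c)  ≡⟨ eq ⟨
    u + s                ≤⟨ +-monoʳ-≤ u s≤c ⟩
    u + c                ≤⟨ +-monoʳ-≤ u (m≤m+n c (q * c)) ⟩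
    u + suc q * c        ∎)
  where open ≤-Reasoning

block⇒clique : ∀ {n} (G : PIG n) {x t} → BlockClique G x t → x ≤ t →
               Σ (List ℕ) λ K → IsClique G K × (∀ {z} → x ≤ z → z ≤ t → z ∈ K)
block⇒clique G {x} {t} (1≤x , t≤n , adjacent) x≤t =
  K , (unique , All.tabulate inV , pairwise) , member
  where
  K : List ℕ
  K = applyUpTo (x +_) (suc t ∸ x)

  x+gap : x + (suc t ∸ x) ≡ suc t
  x+gap = m+[n∸m]≡n (m≤n⇒m≤1+n x≤t)

  bounds : ∀ {z} → z ∈ K → x ≤ z × z ≤ t
  bounds z∈K with i , i<gap , refl ← ∈-applyUpTo⁻ (x +_) z∈K =
    m≤m+n x i , ≤-pred (subst (x + i <_) x+gap (+-monoʳ-< x i<gap))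

  member : ∀ {z} → x ≤ z → z ≤ t → z ∈ K
  member {z} x≤z z≤t =
    subst (_∈ K) (m+[n∸m]≡n x≤z) (∈-applyUpTo⁺ (x +_) (∸-monoˡ-< (s≤s z≤t) x≤z))

  unique : Unique K
  unique = applyUpTo⁺₁ (x +_) (suc t ∸ x) (λ i<j _ eq → <-irrefl (+-cancelˡ-≡ x _ _ eq) i<j)

  inV : ∀ {z} → z ∈ K → InV _ z
  inV z∈K = ≤-trans 1≤x (proj₁ (bounds z∈K)) , ≤-trans (proj₂ (bounds z∈K)) t≤n

  pairwise : ∀ y z → y ∈ K → z ∈ K → y ≢ z → Adj G y z
  pairwise y z y∈K z∈K = adjacent y z (bounds y∈K) (bounds z∈K)

module Counting {n : ℕ} (G : PIG n) {lam C : ℕ} (P : BlockPartition G lam C) where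
  open BlockPartition P

  RightEnd : ℕ → Set
  RightEnd i = ∃ λ a → (a , i) ∈ parts

  part-ordered : ∀ {a b} → (a , b) ∈ parts → a ≤ b
  part-ordered ab = proj₁ (proj₂ (All.lookup good ab))

  part-start-bound : ∀ {a b} → (a , b) ∈ parts → a ≤ suc n
  part-start-bound ab = m≤n⇒m≤1+n (≤-trans (part-ordered ab) (proj₁ (proj₂ (proj₂ (All.lookup good ab)))))

  part-short : ∀ {a b} → (a , b) ∈ parts → suc b ≤ a + C
  part-short ab = proj₁ (proj₂ (proj₂ (proj₂ (All.lookup good ab))))

  part-containing : ∀ {z} → 1 ≤ z → z ≤ n → ∃ λ a → ∃ λ b → (a , b) ∈ parts × a ≤ z × z ≤ b
  part-containing 1≤z z≤N with (a , b) , ab , z∈ab ← cover _ (1≤z , z≤N) = a , b , ab , z∈ab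

  Boundary : ℕ → Set
  Boundary c = ∀ {a b} → (a , b) ∈ parts → b < c ⊎ c ≤ a

  -- a part containing i and i + 1 would share i with the part ending at i
  rightEnd⇒boundary : ∀ {i} → RightEnd i → Boundary (suc i)
  rightEnd⇒boundary {i} (e , ei) {a} {b} ab with b ≤? i | a ≤? i
  ... | yes b≤i | _       = inj₁ (s≤s b≤i)
  ... | no  _   | no a≰i  = inj₂ (≰⇒> a≰i)
  ... | no  b≰i | yes a≤i = ⊥-elim (b≰i (≤-reflexive (cong proj₂ same)))
    where
    same : (a , b) ≡ (e , i)
    same = disjoint a b e i i ab ei (a≤i , <⇒≤ (≰⇒> b≰i)) (part-ordered ei , ≤-refl)

  -- a part containing c ∸ 1 and c would share c with the part starting at c
  leftEnd⇒boundary : ∀ {c d} → (c , d) ∈ parts → Boundary c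
  leftEnd⇒boundary {c} {d} cd {a} {b} ab with b <? c | c ≤? a
  ... | yes b<c | _       = inj₁ b<c
  ... | no  _   | yes c≤a = inj₂ c≤a
  ... | no  b≮c | no  c≰a = ⊥-elim (<-irrefl (cong proj₁ same) (≰⇒> c≰a))
    where
    same : (a , b) ≡ (c , d)
    same = disjoint a b c d c ab cd (<⇒≤ (≰⇒> c≰a) , ≮⇒≥ b≮c) (≤-refl , part-ordered cd)

  RightEndIn : ℕ → ℕ → ℕ × ℕ → Set
  RightEndIn x y p = x ≤ proj₂ p × proj₂ p < y

  Spread : ℕ → ℕ → ℕ → List (ℕ × ℕ) → Set
  Spread x y m Ps = length Ps ≡ m × Unique Ps × All (_∈ parts) Ps × All (RightEndIn x y) Ps

  spread-∷ : ∀ {x y z m p Ps} → p ∈ parts → RightEndIn x z p → y ≤ proj₂ p →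
             Spread x y m Ps → Spread x z (suc m) (p ∷ Ps)
  spread-∷ {x} {y} {z} {p = p} {Ps} p∈P (x≤p , p<z) y≤p (refl , unique , inP , ends) =
    refl , All.map differs ends ∷ unique , p∈P ∷ inP , ends′
    where
    differs : ∀ {q} → RightEndIn x y q → p ≢ q
    differs (_ , q<y) refl = <⇒≱ q<y y≤p
    widen : ∀ {q} → RightEndIn x y q → RightEndIn x z q
    widen (x≤q , q<y) = x≤q , <-trans (<-≤-trans q<y y≤p) p<z
    ends′ : All (RightEndIn x z) (p ∷ Ps)
    ends′ = (x≤p , p<z) ∷ All.map (λ {q} → widen {q}) ends

  -- Spreads of adjacent windows combine: their parts differ by their right ends.
  spread-++ : ∀ {x y z m m' Ps Qs} → x ≤ y → y ≤ z →
              Spread x y m Ps → Spread y z m' Qs → Spread x z (m + m') (Ps ++ Qs)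
  spread-++ {Ps = Ps} x≤y y≤z (refl , uP , inP , endsP) (refl , uQ , inQ , endsQ) =
    length-++ Ps ,
    ++⁺ uP uQ (λ (v∈P , v∈Q) → <⇒≱ (proj₂ (All.lookup endsP v∈P)) (proj₁ (All.lookup endsQ v∈Q))) ,
    AllP.++⁺ inP inQ ,
    AllP.++⁺ (All.map (λ (x≤q , q<y) → x≤q , <-≤-trans q<y y≤z) endsP)
            (All.map (λ (y≤q , q<z) → ≤-trans x≤y y≤q , q<z) endsQ)

  -- Below a boundary y, a window [x , y) with x + (m ∸ 1)·C < y contains a
  -- spread of m parts: the part containing y ∸ 1 ends there, and its left end
  -- is a boundary at most C further to the left.
  chain : ∀ m {x y} → Boundary y → 1 ≤ x → y ≤ suc n → suc (x + m * C) ≤ y + C →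
          ∃ (Spread x y m)
  chain zero _ _ _ _ = [] , refl , [] , [] , []
  chain (suc m) {x} {y} boundary 1≤x y≤1+n room with room-shrinks x m C y room
  ... | s≤s {n = z} x+mC≤z = extend (part-containing (≤-trans 1≤x x≤z) (≤-pred y≤1+n))
    where
    x≤z : x ≤ z
    x≤z = ≤-trans (m≤m+n x (m * C)) x+mC≤z
    extend : (∃ λ a → ∃ λ b → (a , b) ∈ parts × a ≤ z × z ≤ b) → ∃ (Spread x (suc z) (suc m))
    extend (a , b , ab , a≤z , z≤b) with boundary ab
    ... | inj₂ 1+z≤a = ⊥-elim (<⇒≱ (s≤s a≤z) 1+z≤a)
    ... | inj₁ b<1+z =
      let Ps , spread = chain m (leftEnd⇒boundary ab) 1≤x (part-start-bound ab) room′
      in (a , b) ∷ Ps , spread-∷ ab (≤-trans x≤z z≤b , b<1+z) (part-ordered ab) spread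
      where
      room′ : suc (x + m * C) ≤ a + C
      room′ = ≤-trans (s≤s x+mC≤z) (≤-trans (s≤s z≤b) (part-short ab))

  spread-meeting-clique : ∀ {x y m Ps K} → Spread x y m Ps → IsClique G K →
                          All (Meets G K) Ps → m ≤ lam
  spread-meeting-clique {Ps = Ps} (refl , unique , inP , _) clique meets =
    cliques _ clique Ps unique inP meets

  -- Then r + 1 parts end in [x₀ , i], q parts end in [i + 1 , a), and (a , b)
  -- itself meets the block, so the clique meets (r + 1) + (q + 1) parts.
  crowded : ∀ {i x₀ t a b} r q → RightEnd i → BlockClique G x₀ t → x₀ + r * C ≤ i →
            (a , b) ∈ parts → a ≤ t → t ≤ b → i + q * C < b → suc r + suc q ≤ lam
  crowded {i} {x₀} {t} {a} {b} r q end-i block left ab a≤t t≤b right =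
    subst (_≤ lam) (sym (+-suc (suc r) q))
      (spread-meeting-clique all-spread (proj₁ (proj₂ clique-of-block)) (meets-at-t ∷ All.zipWith meets-at-end (inPs , endsPs)))
    where
    i<b : i < b
    i<b = ≤-<-trans (m≤m+n i (q * C)) right
    1+i≤a : suc i ≤ a
    1+i≤a with rightEnd⇒boundary end-i ab
    ... | inj₁ b<1+i = ⊥-elim (<⇒≱ b<1+i i<b)
    ... | inj₂ 1+i≤a = 1+i≤a
    x₀≤i : x₀ ≤ i
    x₀≤i = ≤-trans (m≤m+n x₀ (r * C)) left
    x₀≤t : x₀ ≤ t
    x₀≤t = ≤-trans x₀≤i (<⇒≤ (<-≤-trans 1+i≤a a≤t))

    below-i : ∃ (Spread x₀ (suc i) (suc r))
    below-i = chain (suc r) (rightEnd⇒boundary end-i) (proj₁ block) (≤-trans 1+i≤a (part-start-bound ab))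
      (s≤s (subst (_≤ i + C) (sym (x+[1+m]c≡x+mc+c x₀ r C)) (+-monoˡ-≤ C left)))
    above-i : ∃ (Spread (suc i) a q)
    above-i = chain q (leftEnd⇒boundary ab) (s≤s z≤n) (part-start-bound ab)
      (≤-trans (s≤s right) (part-short ab))

    Ps : List (ℕ × ℕ)
    Ps = proj₁ below-i ++ proj₁ above-i
    spread : Spread x₀ a (suc r + q) Ps
    spread = spread-++ (m≤n⇒m≤1+n x₀≤i) 1+i≤a (proj₂ below-i) (proj₂ above-i)
    inPs : All (_∈ parts) Ps
    inPs = proj₁ (proj₂ (proj₂ spread))
    endsPs : All (RightEndIn x₀ a) Ps
    endsPs = proj₂ (proj₂ (proj₂ spread))
    all-spread : Spread x₀ (suc b) (suc (suc r + q)) ((a , b) ∷ Ps)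
    all-spread = spread-∷ ab (≤-trans x₀≤i (<⇒≤ i<b) , ≤-refl) (part-ordered ab) spread

    clique-of-block : Σ (List ℕ) λ K → IsClique G K × (∀ {z} → x₀ ≤ z → z ≤ t → z ∈ K)
    clique-of-block = block⇒clique G block x₀≤t
    K : List ℕ
    K = proj₁ clique-of-block
    member : ∀ {z} → x₀ ≤ z → z ≤ t → z ∈ K
    member = proj₂ (proj₂ clique-of-block)
    meets-at-t : Meets G K (a , b)
    meets-at-t = t , member x₀≤t ≤-refl , a≤t , t≤b
    -- a part ending in [x₀ , a) meets the block at its right end
    meets-at-end : ∀ {p} → p ∈ parts × RightEndIn x₀ a p → Meets G K p
    meets-at-end {p} (p∈P , x₀≤p , p<a) =
      proj₂ p , member x₀≤p (≤-trans (<⇒≤ p<a) a≤t) , part-ordered p∈P , ≤-refl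

module Forbidden-not-right-end {n : ℕ} (G : PIG n) (C k : ℕ) (P : BlockPartition G (suc k) C) where
  open BlockPartition P
  open Counting G P

  -- r = k, q = 0: the block [i − kC , i + 1] meets k + 2 parts.
  primary-not-end : ∀ {i} → PrimForbidden G C k i → ¬ RightEnd i
  primary-not-end {i} (x₀ , x₀+kC≡i , block) end-i
    with a , b , ab , a≤1+i , 1+i≤b ← part-containing (s≤s z≤n) (proj₁ (proj₂ block)) =
    m+1+n≰m (suc k) (crowded k 0 end-i block (≤-reflexive x₀+kC≡i) ab a≤1+i 1+i≤b
      (subst (_< b) (sym (+-identityʳ i)) 1+i≤b))

  -- r = k − q: the part containing u = v − s + 1 ends beyond v = i + qC, because
  -- no vertex of [u , v] is a right end; again k + 2 parts meet [v − kC , u].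
  rule-not-end : ∀ {v s q i} → RulePremise G C k (λ x → ¬ RightEnd x) v s →
                 1 ≤ q → q ≤ k → i + q * C ≡ v → ¬ RightEnd i
  rule-not-end {v} {s} {q} {i} (_ , s≤C∸1 , u , u+s≡1+v , no-end , x₀ , x₀+kC≡v , block) 1≤q q≤k i+qC≡v end-i =
    too-many (part-containing (≤-trans (s≤s z≤n) i<u) (proj₁ (proj₂ block)))
    where
    i<u : i < u
    i<u = below-gap C (trans u+s≡1+v (cong suc (sym i+qC≡v))) (≤-trans s≤C∸1 (m∸n≤m C 1)) 1≤q
    left : x₀ + (k ∸ q) * C ≤ i
    left = ≤-reflexive (drop-multiples C (trans x₀+kC≡v (sym i+qC≡v)) q≤k)
    k+2≡ : suc (k ∸ q) + suc q ≡ suc (suc k)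
    k+2≡ = trans (+-suc (suc (k ∸ q)) q) (cong (λ m → suc (suc m)) (m∸n+n≡m q≤k))
    too-many : (∃ λ a → ∃ λ b → (a , b) ∈ parts × a ≤ u × u ≤ b) → ⊥
    too-many (a , b , ab , a≤u , u≤b) =
      <-irrefl refl (subst (_≤ suc k) k+2≡
        (crowded (k ∸ q) q end-i block left ab a≤u u≤b (subst (_< b) (sym i+qC≡v) v<b)))
      where
      v<b : v < b
      v<b with b ≤? v
      ... | yes b≤v = ⊥-elim (no-end b (u≤b , b≤v) (a , ab))
      ... | no b≰v = ≰⇒> b≰v

  forbidden-not-end : ∀ {i} → Forbidden G C k i → ¬ RightEnd i
  forbidden-not-end (prim primary) = primary-not-end primary
  forbidden-not-end (rule (1≤s , s≤C∸1 , u , u+s≡1+v , forbidden , clique) 1≤q q≤k i+qC≡v) =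
    rule-not-end (1≤s , s≤C∸1 , u , u+s≡1+v , (λ x x∈ → forbidden-not-end (forbidden x x∈)) , clique)
      1≤q q≤k i+qC≡v

secondary⇒forbidden : ∀ {n} (G : PIG n) (C k : ℕ) {i} → SecForbidden G C k i → Forbidden G C k i
secondary⇒forbidden G C k (_ , _ , _ , premise , 1≤q , q≤k , i+qC≡v) = rule premise 1≤q q≤k i+qC≡v

lemma9 : ∀ {n} (G : PIG n) (C : ℕ) {{_ : NonZero C}} (w : ℕ) → IsOmega G w →
         ∀ i → SecForbidden G C ((w ∸ 1) / C) i →
         (P : BlockPartition G (suc ((w ∸ 1) / C)) C) →
         ¬ (∃ λ a → (a , i) ∈ BlockPartition.parts P)
lemma9 G C w _ i secondary P =
  Forbidden-not-right-end.forbidden-not-end G C k P (secondary⇒forbidden G C k secondary)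
  where
  k : ℕ
  k = (w ∸ 1) / C
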